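{- (1) For $n \geq 2$, the set $\{a, m\}$ is linearly independent in $\mathrm{OS}_n$. (2) For $n \geq 3$, the set $\{am, c\}$ is linearly independent in $\mathrm{OS}_n$.
   Context: $\mathrm{OS}_n$ is the quotient of the exterior algebra over $\mathbb{Q}$ on generators $e_{ij}$, $1 \leq i < j \leq n+1$ (each of degree $1$), by the two-sided ideal generated by $e_{ik}e_{jk} - e_{ij}e_{jk} + e_{ij}e_{ik}$ for $1 \leq i<j<k \leq n+1$. Define $a = \sum_{1\leq i<j\leq n} e_{ij}$, $m = \sum_{1 \leq i \leq n} e_{i,n+1}$, and $c = \sum_{1 \leq i<j\leq n}\big(e_{ij}e_{i,n+1} + e_{ij}e_{j,n+1}\big)$ in $\mathrm{OS}_n$. -}

module Defs where

open import Data.Nat as ℕ using (ℕ; zero; suc)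
open import Data.Bool using (Bool; true; false; _∧_; _∨_; not; if_then_else_)
open import Data.Fin using (Fin; toℕ; inject₁; fromℕ; _<_)
open import Data.Fin.Properties using (_<?_; <-trans; toℕ-inject₁; toℕ-fromℕ; toℕ<n)
open import Data.List using (List; []; _∷_; _++_; map; concatMap; length; foldr; allFin)
open import Data.Bool.ListAction using (any; all)
open import Data.Product using (_×_; _,_; Σ)
open import Data.Rational using (ℚ; 0ℚ; 1ℚ; _+_; _*_; -_)
open import Relation.Binary.PropositionalEquality using (_≡_; subst; sym; cong)
open import Relation.Nullary using (yes; no)

private variable n : ℕ

-- Generators e_{ij} of OS_n, 1 ≤ i < j ≤ n+1, are indexed 0-based by
-- i < j in Fin (suc n); the paper's index n+1 is  fromℕ n.

record Gen (n : ℕ) : Set where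
  constructor gen
  field
    i j : Fin (suc n)
    i<j : i < j

_==ᴳ_ : Gen n → Gen n → Bool
g ==ᴳ h = (toℕ (Gen.i g) ℕ.≡ᵇ toℕ (Gen.i h)) ∧ (toℕ (Gen.j g) ℕ.≡ᵇ toℕ (Gen.j h))

_>ᴳ_ : Gen n → Gen n → Bool
g >ᴳ h = (toℕ (Gen.i h) ℕ.<ᵇ toℕ (Gen.i g))
       ∨ ((toℕ (Gen.i g) ℕ.≡ᵇ toℕ (Gen.i h)) ∧ (toℕ (Gen.j h) ℕ.<ᵇ toℕ (Gen.j g)))

-- A word e_{g1} ⋯ e_{gk} is a list of generators; an element is a finite
-- formal ℚ-linear combination of words.  Its coefficient on the basis
-- monomial S (for S a strictly increasing word) is computed by the exterior
-- relations: a word w equals ±S (sign of the permutation, i.e. parity of the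
-- number of inversions) if w has no repeated letter and is a rearrangement
-- of S, and 0 otherwise (repeated letter, e_g e_g = 0).

Word : ℕ → Set
Word n = List (Gen n)

Λ : ℕ → Set
Λ n = List (ℚ × Word n)

memᴳ : Gen n → Word n → Bool
memᴳ g w = any (g ==ᴳ_) w

distinctᴳ : Word n → Bool
distinctᴳ [] = true
distinctᴳ (g ∷ w) = not (memᴳ g w) ∧ distinctᴳ w

inversions : Word n → ℕ
inversions [] = 0
inversions (g ∷ w) = length (Data.List.filterᵇ (g >ᴳ_) w) ℕ.+ inversions w
  where import Data.List

paritySign : ℕ → ℚ
paritySign zero = 1ℚ
paritySign (suc k) = - paritySign k

coeffWord : Word n → Word n → ℚ
coeffWord w S =
  if distinctᴳ w ∧ (length w ℕ.≡ᵇ length S) ∧ all (λ g → memᴳ g S) w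
  then paritySign (inversions w) else 0ℚ

coeff : Λ n → Word n → ℚ
coeff x S = foldr (λ t acc → Data.Product.proj₁ t * coeffWord (Data.Product.proj₂ t) S + acc) 0ℚ x
  where import Data.Product

_≈Λ_ : Λ n → Λ n → Set
x ≈Λ y = ∀ S → coeff x S ≡ coeff y S

_+Λ_ : Λ n → Λ n → Λ n
x +Λ y = x ++ y

_·Λ_ : ℚ → Λ n → Λ n
q ·Λ x = map (λ t → (q * Data.Product.proj₁ t , Data.Product.proj₂ t)) x
  where import Data.Product

_*Λ_ : Λ n → Λ n → Λ n
x *Λ y = concatMap (λ s → map (λ t → (Data.Product.proj₁ s * Data.Product.proj₁ t ,
                                      Data.Product.proj₂ s ++ Data.Product.proj₂ t)) y) x
  where import Data.Product

0Λ : Λ n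
0Λ = []

e : Gen n → Λ n
e g = (1ℚ , g ∷ []) ∷ []

record Triple (n : ℕ) : Set where
  constructor triple
  field
    i j k : Fin (suc n)
    i<j : i < j
    j<k : j < k

rel : Triple n → Λ n
rel (triple i j k i<j j<k) =
  (eik *Λ ejk) +Λ (((- 1ℚ) ·Λ (eij *Λ ejk)) +Λ (eij *Λ eik))
  where
    eij = e (gen i j i<j)
    ejk = e (gen j k j<k)
    eik = e (gen i k (<-trans i<j j<k))

idealSum : List (Λ n × Triple n × Λ n) → Λ n
idealSum [] = 0Λ
idealSum ((x , t , y) ∷ L) = ((x *Λ rel t) *Λ y) +Λ idealSum L

InIdeal : Λ n → Set
InIdeal {n} z = Σ (List (Λ n × Triple n × Λ n)) (λ L → z ≈Λ idealSum L)

_≈OS_ : Λ n → Λ n → Set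
x ≈OS y = InIdeal (x +Λ ((- 1ℚ) ·Λ y))

LinIndep₂ : Λ n → Λ n → Set
LinIndep₂ x y = ∀ (λ₁ λ₂ : ℚ) → ((λ₁ ·Λ x) +Λ (λ₂ ·Λ y)) ≈OS 0Λ → (λ₁ ≡ 0ℚ) × (λ₂ ≡ 0ℚ)

lowPairs : (n : ℕ) → List (Gen n)
lowPairs n = concatMap (λ i → concatMap (λ j → pick i j) (allFin n)) (allFin n)
  where
    pick : Fin n → Fin n → List (Gen n)
    pick i j with inject₁ i <? inject₁ j
    ... | yes p = gen (inject₁ i) (inject₁ j) p ∷ []
    ... | no _  = []

inj<last : (i : Fin n) → inject₁ i < fromℕ n
inj<last {n} i = subst (λ k → k ℕ.< toℕ (fromℕ n)) (sym (toℕ-inject₁ i))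
                   (subst (λ k → toℕ i ℕ.< k) (sym (toℕ-fromℕ n)) (toℕ<n i))

toLast : Fin n → Gen n
toLast i = gen (inject₁ i) (fromℕ _) (inj<last i)

sumΛ : List (Λ n) → Λ n
sumΛ = foldr _+Λ_ 0Λ

a : (n : ℕ) → Λ n
a n = sumΛ (map e (lowPairs n))

m : (n : ℕ) → Λ n
m n = sumΛ (map (λ i → e (toLast i)) (allFin n))

c : (n : ℕ) → Λ n
c n = sumΛ (concatMap (λ i → concatMap (λ j → pick i j) (allFin n)) (allFin n))
  where
    pick : Fin n → Fin n → List (Λ n)
    pick i j with inject₁ i <? inject₁ j
    ... | yes p = (e (gen (inject₁ i) (inject₁ j) p) *Λ e (toLast i))
                ∷ (e (gen (inject₁ i) (inject₁ j) p) *Λ e (toLast j)) ∷ []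
    ... | no _  = []

-- A functional on the exterior algebra that vanishes on words of length > 2 and on each relation
-- e_ik e_jk − e_ij e_jk + e_ij e_ik vanishes on the ideal they generate, hence is a functional on
-- OS_n; {x, y} is then independent as soon as two such functionals f, g have f x = 1, f y = 0 and
-- g y = 1.  For {a, m} take the coefficients of e_12 and e_{1,n+1}.  For {am, c} take the
-- coefficient of e_12 e_{3,n+1}, which occurs neither in a relation nor in c since each of their
-- monomials is a pair of edges with a common vertex, and the coefficient of e_12 e_{1,n+1} minus
-- that of e_{1,n+1} e_{2,n+1}: these two monomials occur only in the relation of the triangle
-- 1 < 2 < n+1, each with coefficient 1.

module Submission where

open import Algebra.Bundles using (CommutativeSemiring)
open import Data.Fin using (Fin) renaming (zero to fz; suc to fs)
open import Data.Fin.Properties using (suc-injective)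
open import Data.List using (List; []; _∷_; _++_; map; concatMap; foldr; allFin)
open import Data.List.Properties using (map-tabulate)
open import Data.Nat using (ℕ; suc)
open import Data.Product using (_×_; _,_)
open import Function using (_∘_; id)
open import Relation.Binary.PropositionalEquality as ≡ using (_≡_; _≢_)
open import Relation.Nullary using (¬_)

module ListSum {c ℓ} (R : CommutativeSemiring c ℓ) where
  open CommutativeSemiring R
  open import Relation.Binary.Reasoning.Setoid setoid
  open import Algebra.Properties.CommutativeSemigroup +-commutativeSemigroup using (interchange)

  private variable A B : Set

  ∑ : List A → (A → Carrier) → Carrier
  ∑ xs h = foldr (λ x acc → h x + acc) 0# xs

  ∑-++ : (xs ys : List A) (h : A → Carrier) → ∑ (xs ++ ys) h ≈ ∑ xs h + ∑ ys h
  ∑-++ []       ys h = sym (+-identityˡ _)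
  ∑-++ (x ∷ xs) ys h = trans (+-congˡ (∑-++ xs ys h)) (sym (+-assoc _ _ _))

  ∑-cong : (xs : List A) {h k : A → Carrier} → (∀ x → h x ≈ k x) → ∑ xs h ≈ ∑ xs k
  ∑-cong []       h≈k = refl
  ∑-cong (x ∷ xs) h≈k = +-cong (h≈k x) (∑-cong xs h≈k)

  ∑-zero : (xs : List A) {h : A → Carrier} → (∀ x → h x ≈ 0#) → ∑ xs h ≈ 0#
  ∑-zero []       h≈0 = refl
  ∑-zero (x ∷ xs) h≈0 = trans (+-cong (h≈0 x) (∑-zero xs h≈0)) (+-identityˡ 0#)

  ∑-+ : (xs : List A) (h k : A → Carrier) → ∑ xs (λ x → h x + k x) ≈ ∑ xs h + ∑ xs k
  ∑-+ []       h k = sym (+-identityˡ 0#)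
  ∑-+ (x ∷ xs) h k = trans (+-congˡ (∑-+ xs h k)) (interchange _ _ _ _)

  ∑-*ˡ : (xs : List A) (q : Carrier) (h : A → Carrier) → ∑ xs (λ x → q * h x) ≈ q * ∑ xs h
  ∑-*ˡ []       q h = sym (zeroʳ q)
  ∑-*ˡ (x ∷ xs) q h = trans (+-congˡ (∑-*ˡ xs q h)) (sym (distribˡ q _ _))

  ∑-map : (f : B → A) (xs : List B) (h : A → Carrier) → ∑ (map f xs) h ≡ ∑ xs (h ∘ f)
  ∑-map f []       h = ≡.refl
  ∑-map f (x ∷ xs) h = ≡.cong (h (f x) +_) (∑-map f xs h)

  ∑-concatMap : (F : B → List A) (xs : List B) (h : A → Carrier) →
                ∑ (concatMap F xs) h ≈ ∑ xs (λ x → ∑ (F x) h)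
  ∑-concatMap F []       h = refl
  ∑-concatMap F (x ∷ xs) h = trans (∑-++ (F x) _ h) (+-congˡ (∑-concatMap F xs h))

  ∑-comm : (xs : List A) (ys : List B) (h : A → B → Carrier) →
           ∑ xs (λ x → ∑ ys (h x)) ≈ ∑ ys (λ y → ∑ xs (λ x → h x y))
  ∑-comm []       ys h = sym (∑-zero ys (λ _ → refl))
  ∑-comm (x ∷ xs) ys h = begin
    ∑ ys (h x) + ∑ xs (λ x′ → ∑ ys (h x′))           ≈⟨ +-congˡ (∑-comm xs ys h) ⟩
    ∑ ys (h x) + ∑ ys (λ y → ∑ xs (λ x′ → h x′ y))   ≈⟨ ∑-+ ys (h x) _ ⟨
    ∑ ys (λ y → h x y + ∑ xs (λ x′ → h x′ y))        ∎

  ∑-allFin-δ : {k : ℕ} (i₀ : Fin k) (h : Fin k → Carrier) → (∀ i → i ≢ i₀ → h i ≈ 0#) → ∑ (allFin k) h ≈ h i₀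
  ∑-allFin-δ {suc k} i₀ h h≈0 = begin
    ∑ (allFin (suc k)) h                 ≡⟨ ≡.cong (λ is → h fz + ∑ is h) (≡.sym (map-tabulate id fs)) ⟩
    h fz + ∑ (map fs (allFin k)) h       ≡⟨ ≡.cong (h fz +_) (∑-map fs (allFin k) h) ⟩
    h fz + ∑ (allFin k) (h ∘ fs)         ≈⟨ split i₀ h≈0 ⟩
    h i₀                                 ∎
    where
    split : (i₀ : Fin (suc k)) → (∀ i → i ≢ i₀ → h i ≈ 0#) → h fz + ∑ (allFin k) (h ∘ fs) ≈ h i₀
    split fz       h≈0 = trans (+-congˡ (∑-zero (allFin k) (λ i → h≈0 (fs i) λ ()))) (+-identityʳ _)
    split (fs i₀)  h≈0 = trans
      (+-cong (h≈0 fz λ ()) (∑-allFin-δ i₀ (h ∘ fs) (λ i i≢i₀ → h≈0 (fs i) (i≢i₀ ∘ suc-injective))))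
      (+-identityˡ _)

  ∑-allFin²-δ : {k : ℕ} (i₀ j₀ : Fin k) (H : Fin k → Fin k → Carrier) →
                (∀ i j → ¬ (i ≡ i₀ × j ≡ j₀) → H i j ≈ 0#) →
                ∑ (allFin k) (λ i → ∑ (allFin k) (H i)) ≈ H i₀ j₀
  ∑-allFin²-δ i₀ j₀ H H≈0 = trans
    (∑-allFin-δ i₀ _ (λ i i≢i₀ → ∑-zero (allFin _) (λ j → H≈0 i j (λ (i≡i₀ , _) → i≢i₀ i≡i₀))))
    (∑-allFin-δ j₀ _ (λ j j≢j₀ → H≈0 i₀ j (λ (_ , j≡j₀) → j≢j₀ j≡j₀)))

open import Defs
open import Algebra.Bundles using (CommutativeRing)
open import Data.Bool using (true; false; _∧_; _∨_)
open import Data.Bool.ListAction using (all)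
open import Data.Bool.Properties using (∧-zeroʳ)
open import Data.Empty using (⊥-elim)
open import Data.Fin using (toℕ; inject₁; fromℕ; _<_)
open import Data.Fin.Properties using (_<?_; <-trans; toℕ-inject₁; toℕ-injective; toℕ-fromℕ; toℕ<n; <-irrelevant)
open import Data.List using (length)
open import Data.List.Membership.Propositional using (_∈_)
open import Data.List.Properties using (++-identityʳ; length-++-≤ˡ; length-++-≤ʳ)
open import Data.List.Relation.Unary.All using (All; []; _∷_)
open import Data.List.Relation.Unary.Any using (here; there)
open import Data.Nat as ℕ using (z≤n; s≤s; _≤_)
import Data.Nat.Properties as ℕ
open import Data.Product using (proj₁; ∃)
open import Data.Rational using (ℚ; 0ℚ; 1ℚ; _+_; _*_; -_; _-_)
import Data.Rational.Properties as ℚ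
open import Data.Rational.Solver using (module +-*-Solver)
open import Data.Sum using (_⊎_; inj₁; inj₂; [_,_])
open import Relation.Binary.PropositionalEquality using (refl; sym; trans; cong; cong₂; subst₂; module ≡-Reasoning)
open import Relation.Nullary using (Dec; yes; no)
open import Relation.Nullary.Decidable using (_×-dec_; _⊎-dec_; map′; dec-true; dec-false)

open +-*-Solver using (solve; _:=_; _:+_; _:*_; _:-_; con)

open ListSum (CommutativeRing.commutativeSemiring ℚ.+-*-commutativeRing)
open ≡-Reasoning

private variable
  n : ℕ

⟪_⟫ : (Word n → ℚ) → Λ n → ℚ
⟪ f ⟫ x = ∑ x (λ (q , w) → q * f w)

⟪⟫-cong : {f g : Word n → ℚ} (x : Λ n) → (∀ w → f w ≡ g w) → ⟪ f ⟫ x ≡ ⟪ g ⟫ x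
⟪⟫-cong x f≗g = ∑-cong x (λ (q , w) → cong (q *_) (f≗g w))

⟪⟫-zero : {f : Word n → ℚ} (x : Λ n) → (∀ w → f w ≡ 0ℚ) → ⟪ f ⟫ x ≡ 0ℚ
⟪⟫-zero x f≡0 = ∑-zero x (λ (q , w) → trans (cong (q *_) (f≡0 w)) (ℚ.*-zeroʳ q))

⟪⟫-+Λ : (f : Word n → ℚ) (x y : Λ n) → ⟪ f ⟫ (x +Λ y) ≡ ⟪ f ⟫ x + ⟪ f ⟫ y
⟪⟫-+Λ f x y = ∑-++ x y (λ (q , w) → q * f w)

⟪⟫-·Λ : (f : Word n → ℚ) (q : ℚ) (x : Λ n) → ⟪ f ⟫ (q ·Λ x) ≡ q * ⟪ f ⟫ x
⟪⟫-·Λ f q x = begin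
  ∑ (map (λ (p , w) → (q * p , w)) x) (λ (r , w) → r * f w)
                                    ≡⟨ ∑-map (λ (p , w) → (q * p , w)) x (λ (r , w) → r * f w) ⟩
  ∑ x (λ (p , w) → (q * p) * f w)   ≡⟨ ∑-cong x (λ (p , w) → ℚ.*-assoc q p (f w)) ⟩
  ∑ x (λ (p , w) → q * (p * f w))   ≡⟨ ∑-*ˡ x q (λ (p , w) → p * f w) ⟩
  q * ⟪ f ⟫ x                       ∎

⟪⟫-*Λ : (f : Word n → ℚ) (x y : Λ n) → ⟪ f ⟫ (x *Λ y) ≡ ⟪ (λ u → ⟪ (λ v → f (u ++ v)) ⟫ y) ⟫ x
⟪⟫-*Λ f x y = trans (∑-concatMap (λ (p , u) → map (λ (q , v) → (p * q , u ++ v)) y) x (λ (r , w) → r * f w))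
                    (∑-cong x (λ (p , u) → row p u))
  where
  row : (p : ℚ) (u : Word _) →
        ∑ (map (λ (q , v) → (p * q , u ++ v)) y) (λ (r , w) → r * f w) ≡ p * ⟪ (λ v → f (u ++ v)) ⟫ y
  row p u = begin
    ∑ (map (λ (q , v) → (p * q , u ++ v)) y) (λ (r , w) → r * f w)
                                            ≡⟨ ∑-map (λ (q , v) → (p * q , u ++ v)) y (λ (r , w) → r * f w) ⟩
    ∑ y (λ (q , v) → (p * q) * f (u ++ v))  ≡⟨ ∑-cong y (λ (q , v) → ℚ.*-assoc p q (f (u ++ v))) ⟩
    ∑ y (λ (q , v) → p * (q * f (u ++ v)))  ≡⟨ ∑-*ˡ y p (λ (q , v) → q * f (u ++ v)) ⟩
    p * ⟪ (λ v → f (u ++ v)) ⟫ y            ∎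

⟪⟫-comm : (h : Word n → Word n → ℚ) (x y : Λ n) →
          ⟪ (λ u → ⟪ h u ⟫ y) ⟫ x ≡ ⟪ (λ v → ⟪ (λ u → h u v) ⟫ x) ⟫ y
⟪⟫-comm h x y = begin
  ∑ x (λ (p , u) → p * ∑ y (λ (q , v) → q * h u v))
    ≡⟨ ∑-cong x (λ (p , u) → sym (∑-*ˡ y p (λ (q , v) → q * h u v))) ⟩
  ∑ x (λ (p , u) → ∑ y (λ (q , v) → p * (q * h u v)))
    ≡⟨ ∑-comm x y (λ (p , u) (q , v) → p * (q * h u v)) ⟩
  ∑ y (λ (q , v) → ∑ x (λ (p , u) → p * (q * h u v)))
    ≡⟨ ∑-cong y (λ (q , v) → ∑-cong x (λ (p , u) → swap p q (h u v))) ⟩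
  ∑ y (λ (q , v) → ∑ x (λ (p , u) → q * (p * h u v)))
    ≡⟨ ∑-cong y (λ (q , v) → ∑-*ˡ x q (λ (p , u) → p * h u v)) ⟩
  ∑ y (λ (q , v) → q * ∑ x (λ (p , u) → p * h u v))
    ∎
  where
  swap : ∀ p q r → p * (q * r) ≡ q * (p * r)
  swap = solve 3 (λ p q r → p :* (q :* r) := q :* (p :* r)) refl

⟪⟫-sumΛ : (f : Word n → ℚ) (xs : List (Λ n)) → ⟪ f ⟫ (sumΛ xs) ≡ ∑ xs ⟪ f ⟫
⟪⟫-sumΛ f []       = refl
⟪⟫-sumΛ f (x ∷ xs) = trans (⟪⟫-+Λ f x (sumΛ xs)) (cong (⟪ f ⟫ x +_) (⟪⟫-sumΛ f xs))

⟪⟫-e : (f : Word n → ℚ) (g : Gen n) → ⟪ f ⟫ (e g) ≡ f (g ∷ [])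
⟪⟫-e f g = trans (ℚ.+-identityʳ _) (ℚ.*-identityˡ _)

⟪⟫-e*e : (f : Word n → ℚ) (g h : Gen n) → ⟪ f ⟫ (e g *Λ e h) ≡ f (g ∷ h ∷ [])
⟪⟫-e*e f g h = trans (ℚ.+-identityʳ _) (ℚ.*-identityˡ _)

ikjk ijjk ijik : Triple n → Word n
ikjk (triple i j k i<j j<k) = gen i k (<-trans i<j j<k) ∷ gen j k j<k ∷ []
ijjk (triple i j k i<j j<k) = gen i j i<j ∷ gen j k j<k ∷ []
ijik (triple i j k i<j j<k) = gen i j i<j ∷ gen i k (<-trans i<j j<k) ∷ []

⟪⟫-rel : (f : Word n → ℚ) (t : Triple n) → ⟪ f ⟫ (rel t) ≡ f (ikjk t) - f (ijjk t) + f (ijik t)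
⟪⟫-rel f t@(triple _ _ _ _ _) =
  solve 3 (λ A B C → con 1ℚ :* A :+ (con (- 1ℚ) :* B :+ (con 1ℚ :* C :+ con 0ℚ)) := A :- B :+ C) refl
          (f (ikjk t)) (f (ijjk t)) (f (ijik t))

⟪⟫-rel-vanishing : (f : Word n → ℚ) (t : Triple n) → (∀ g h → f (g ∷ h ∷ []) ≡ 0ℚ) → ⟪ f ⟫ (rel t) ≡ 0ℚ
⟪⟫-rel-vanishing f t@(triple _ _ _ _ _) f≡0 = begin
  ⟪ f ⟫ (rel t)                              ≡⟨ ⟪⟫-rel f t ⟩
  f (ikjk t) - f (ijjk t) + f (ijik t)       ≡⟨ cong₂ _+_ (cong₂ _-_ (f≡0 _ _) (f≡0 _ _)) (f≡0 _ _) ⟩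
  0ℚ - 0ℚ + 0ℚ                               ≡⟨⟩
  0ℚ                                         ∎

Degree≤2 : (Word n → ℚ) → Set
Degree≤2 f = ∀ w → 2 ℕ.< length w → f w ≡ 0ℚ

KillsRelations : (Word n → ℚ) → Set
KillsRelations {n} f = (t : Triple n) → ⟪ f ⟫ (rel t) ≡ 0ℚ

⟪⟫-sandwich : {f : Word n → ℚ} → Degree≤2 f → KillsRelations f →
              (x : Λ n) (t : Triple n) (y : Λ n) → ⟪ f ⟫ ((x *Λ rel t) *Λ y) ≡ 0ℚ
⟪⟫-sandwich {f = f} deg kill x t y = begin
  ⟪ f ⟫ ((x *Λ rel t) *Λ y)                                                 ≡⟨ ⟪⟫-*Λ f (x *Λ rel t) y ⟩
  ⟪ (λ u → ⟪ (λ v → f (u ++ v)) ⟫ y) ⟫ (x *Λ rel t)                          ≡⟨ ⟪⟫-*Λ _ x (rel t) ⟩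
  ⟪ (λ u₀ → ⟪ (λ u₁ → ⟪ (λ v → f ((u₀ ++ u₁) ++ v)) ⟫ y) ⟫ (rel t)) ⟫ x     ≡⟨ ⟪⟫-zero x middle ⟩
  0ℚ                                                                        ∎
  where
  -- A word of x · r · y is u₀ ++ u₁ ++ v with u₁ a word of r, of length 2, so only u₀ = v = [] survives.
  padded : ∀ u₀ v → ⟪ (λ u₁ → f ((u₀ ++ u₁) ++ v)) ⟫ (rel t) ≡ 0ℚ
  padded []       []        = trans (⟪⟫-cong (rel t) (λ u → cong f (++-identityʳ u))) (kill t)
  padded []       v@(_ ∷ _) = ⟪⟫-rel-vanishing (λ u₁ → f (u₁ ++ v)) t (λ _ _ → deg _ (s≤s (s≤s (s≤s z≤n))))
  padded (g₀ ∷ u₀) v        = ⟪⟫-rel-vanishing (λ u₁ → f (((g₀ ∷ u₀) ++ u₁) ++ v)) t (λ g h → deg _ (s≤s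
    (ℕ.≤-trans (length-++-≤ʳ (g ∷ h ∷ []) {u₀}) (length-++-≤ˡ (u₀ ++ g ∷ h ∷ [])))))
  middle : ∀ u₀ → ⟪ (λ u₁ → ⟪ (λ v → f ((u₀ ++ u₁) ++ v)) ⟫ y) ⟫ (rel t) ≡ 0ℚ
  middle u₀ = trans (⟪⟫-comm (λ u₁ v → f ((u₀ ++ u₁) ++ v)) (rel t) y) (⟪⟫-zero y (padded u₀))

⟪⟫-idealSum : {f : Word n → ℚ} → Degree≤2 f → KillsRelations f →
              (L : List (Λ n × Triple n × Λ n)) → ⟪ f ⟫ (idealSum L) ≡ 0ℚ
⟪⟫-idealSum deg kill [] = refl
⟪⟫-idealSum {f = f} deg kill ((x , t , y) ∷ L) = begin
  ⟪ f ⟫ (((x *Λ rel t) *Λ y) +Λ idealSum L)        ≡⟨ ⟪⟫-+Λ f ((x *Λ rel t) *Λ y) (idealSum L) ⟩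
  ⟪ f ⟫ ((x *Λ rel t) *Λ y) + ⟪ f ⟫ (idealSum L)   ≡⟨ cong₂ _+_ (⟪⟫-sandwich deg kill x t y) (⟪⟫-idealSum deg kill L) ⟩
  0ℚ + 0ℚ                                          ≡⟨⟩
  0ℚ                                               ∎

AnnihilatesIdeal : (Word n → ℚ) → Set
AnnihilatesIdeal {n} f = (z : Λ n) → InIdeal z → ⟪ f ⟫ z ≡ 0ℚ

linIndep₂-triangular : {f g : Word n → ℚ} (x y : Λ n) → AnnihilatesIdeal f → AnnihilatesIdeal g →
                       ⟪ f ⟫ x ≡ 1ℚ → ⟪ f ⟫ y ≡ 0ℚ → ⟪ g ⟫ y ≡ 1ℚ → LinIndep₂ x y
linIndep₂-triangular {f = f} {g} x y f-ann g-ann fx≡1 fy≡0 gy≡1 λ₁ λ₂ z∈I = λ₁≡0 , λ₂≡0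
  where
  z = ((λ₁ ·Λ x) +Λ (λ₂ ·Λ y)) +Λ ((- 1ℚ) ·Λ 0Λ)
  ⟪⟫-combination : (h : Word _ → ℚ) → ⟪ h ⟫ z ≡ λ₁ * ⟪ h ⟫ x + λ₂ * ⟪ h ⟫ y
  ⟪⟫-combination h = begin
    ⟪ h ⟫ (((λ₁ ·Λ x) +Λ (λ₂ ·Λ y)) +Λ [])   ≡⟨ cong ⟪ h ⟫ (++-identityʳ ((λ₁ ·Λ x) +Λ (λ₂ ·Λ y))) ⟩
    ⟪ h ⟫ ((λ₁ ·Λ x) +Λ (λ₂ ·Λ y))           ≡⟨ ⟪⟫-+Λ h (λ₁ ·Λ x) (λ₂ ·Λ y) ⟩
    ⟪ h ⟫ (λ₁ ·Λ x) + ⟪ h ⟫ (λ₂ ·Λ y)        ≡⟨ cong₂ _+_ (⟪⟫-·Λ h λ₁ x) (⟪⟫-·Λ h λ₂ y) ⟩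
    λ₁ * ⟪ h ⟫ x + λ₂ * ⟪ h ⟫ y              ∎
  λ₁≡0 : λ₁ ≡ 0ℚ
  λ₁≡0 = begin
    λ₁                            ≡⟨ solve 2 (λ l₁ l₂ → l₁ := l₁ :* con 1ℚ :+ l₂ :* con 0ℚ) refl λ₁ λ₂ ⟩
    λ₁ * 1ℚ + λ₂ * 0ℚ             ≡⟨ cong₂ (λ u v → λ₁ * u + λ₂ * v) fx≡1 fy≡0 ⟨
    λ₁ * ⟪ f ⟫ x + λ₂ * ⟪ f ⟫ y   ≡⟨ ⟪⟫-combination f ⟨
    ⟪ f ⟫ z                       ≡⟨ f-ann z z∈I ⟩
    0ℚ                            ∎
  λ₂≡0 : λ₂ ≡ 0ℚ
  λ₂≡0 = begin
    λ₂                            ≡⟨ solve 2 (λ l₂ gx → l₂ := con 0ℚ :* gx :+ l₂ :* con 1ℚ) refl λ₂ (⟪ g ⟫ x) ⟩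
    0ℚ * ⟪ g ⟫ x + λ₂ * 1ℚ        ≡⟨ cong₂ (λ u v → u * ⟪ g ⟫ x + λ₂ * v) λ₁≡0 gy≡1 ⟨
    λ₁ * ⟪ g ⟫ x + λ₂ * ⟪ g ⟫ y   ≡⟨ ⟪⟫-combination g ⟨
    ⟪ g ⟫ z                       ≡⟨ g-ann z z∈I ⟩
    0ℚ                            ∎

record _≈ᴳ_ (g h : Gen n) : Set where
  constructor _,_
  field
    i≡ : toℕ (Gen.i g) ≡ toℕ (Gen.i h)
    j≡ : toℕ (Gen.j g) ≡ toℕ (Gen.j h)

_≈ᴳ?_ : (g h : Gen n) → Dec (g ≈ᴳ h)
g ≈ᴳ? h = map′ (λ (i≡ , j≡) → i≡ , j≡) (λ (i≡ , j≡) → i≡ , j≡)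
               ((toℕ (Gen.i g) ℕ.≟ toℕ (Gen.i h)) ×-dec (toℕ (Gen.j g) ℕ.≟ toℕ (Gen.j h)))

≈ᴳ-sym : {g h : Gen n} → g ≈ᴳ h → h ≈ᴳ g
≈ᴳ-sym (i≡ , j≡) = sym i≡ , sym j≡

≈ᴳ-trans : {g h k : Gen n} → g ≈ᴳ h → h ≈ᴳ k → g ≈ᴳ k
≈ᴳ-trans (i≡ , j≡) (i≡′ , j≡′) = trans i≡ i≡′ , trans j≡ j≡′

-- The order whose inversions give the sign of a word; the equation in <ᴳ-j is oriented as in _>ᴳ_.
data _<ᴳ_ (g h : Gen n) : Set where
  <ᴳ-i : toℕ (Gen.i g) ℕ.< toℕ (Gen.i h) → g <ᴳ h
  <ᴳ-j : toℕ (Gen.i h) ≡ toℕ (Gen.i g) → toℕ (Gen.j g) ℕ.< toℕ (Gen.j h) → g <ᴳ h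

_<ᴳ?_ : (g h : Gen n) → Dec (g <ᴳ h)
g <ᴳ? h = map′ [ <ᴳ-i , (λ (i≡ , j<) → <ᴳ-j i≡ j<) ]
               (λ { (<ᴳ-i i<) → inj₁ i< ; (<ᴳ-j i≡ j<) → inj₂ (i≡ , j<) })
               ((toℕ (Gen.i g) ℕ.<? toℕ (Gen.i h))
                ⊎-dec ((toℕ (Gen.i h) ℕ.≟ toℕ (Gen.i g)) ×-dec (toℕ (Gen.j g) ℕ.<? toℕ (Gen.j h))))

<ᴳ-asym : {g h : Gen n} → g <ᴳ h → ¬ h <ᴳ g
<ᴳ-asym (<ᴳ-i i<i′)     (<ᴳ-i i′<i)     = ℕ.<-asym i<i′ i′<i
<ᴳ-asym (<ᴳ-i i<i′)     (<ᴳ-j i≡i′ _)   = ℕ.<⇒≢ i<i′ i≡i′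
<ᴳ-asym (<ᴳ-j i′≡i _)   (<ᴳ-i i′<i)     = ℕ.<⇒≢ i′<i i′≡i
<ᴳ-asym (<ᴳ-j _ j<j′)   (<ᴳ-j _ j′<j)   = ℕ.<-asym j<j′ j′<j

<ᴳ⇒≉ᴳ : {g h : Gen n} → g <ᴳ h → ¬ g ≈ᴳ h
<ᴳ⇒≉ᴳ (<ᴳ-i i<i′)   (i≡i′ , _) = ℕ.<⇒≢ i<i′ i≡i′
<ᴳ⇒≉ᴳ (<ᴳ-j _ j<j′) (_ , j≡j′) = ℕ.<⇒≢ j<j′ j≡j′

-- By construction, does (g ≈ᴳ? h) unfolds to g ==ᴳ h and does (h <ᴳ? g) to g >ᴳ h.
==ᴳ-≈ᴳ : {g h : Gen n} → g ≈ᴳ h → (g ==ᴳ h) ≡ true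
==ᴳ-≈ᴳ {g = g} {h} = dec-true (g ≈ᴳ? h)

==ᴳ-≉ᴳ : {g h : Gen n} → ¬ g ≈ᴳ h → (g ==ᴳ h) ≡ false
==ᴳ-≉ᴳ {g = g} {h} = dec-false (g ≈ᴳ? h)

>ᴳ-<ᴳ : {g h : Gen n} → g <ᴳ h → (g >ᴳ h) ≡ false
>ᴳ-<ᴳ {g = g} {h} g<h = dec-false (h <ᴳ? g) (<ᴳ-asym g<h)

memᴳ-∉ : {g : Gen n} (S : Word n) → All (λ s → ¬ g ≈ᴳ s) S → memᴳ g S ≡ false
memᴳ-∉ []      []            = refl
memᴳ-∉ (s ∷ S) (g≉s ∷ g∉S)  = cong₂ _∨_ (==ᴳ-≉ᴳ g≉s) (memᴳ-∉ S g∉S)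

coeffWord-vanishing : (w S : Word n) →
  (distinctᴳ w ∧ (length w ℕ.≡ᵇ length S) ∧ all (λ g → memᴳ g S) w) ≡ false → coeffWord w S ≡ 0ℚ
coeffWord-vanishing w S cond≡false rewrite cond≡false = refl

coeffWord-length : (w S : Word n) → length w ≢ length S → coeffWord w S ≡ 0ℚ
coeffWord-length w S |w|≢|S| = coeffWord-vanishing w S (begin
  distinctᴳ w ∧ (length w ℕ.≡ᵇ length S) ∧ all (λ g → memᴳ g S) w
    ≡⟨ cong (λ b → distinctᴳ w ∧ b ∧ all (λ g → memᴳ g S) w) (dec-false (length w ℕ.≟ length S) |w|≢|S|) ⟩
  distinctᴳ w ∧ false
    ≡⟨ ∧-zeroʳ (distinctᴳ w) ⟩
  false ∎)

coeffWord-∉ : (w S : Word n) {g : Gen n} → g ∈ w → All (λ s → ¬ g ≈ᴳ s) S → coeffWord w S ≡ 0ℚ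
coeffWord-∉ w S g∈w g∉S = coeffWord-vanishing w S (begin
  distinctᴳ w ∧ (length w ℕ.≡ᵇ length S) ∧ all (λ g → memᴳ g S) w
    ≡⟨ cong (λ b → distinctᴳ w ∧ (length w ℕ.≡ᵇ length S) ∧ b) (all-false g∈w) ⟩
  distinctᴳ w ∧ (length w ℕ.≡ᵇ length S) ∧ false
    ≡⟨ cong (distinctᴳ w ∧_) (∧-zeroʳ _) ⟩
  distinctᴳ w ∧ false
    ≡⟨ ∧-zeroʳ (distinctᴳ w) ⟩
  false ∎)
  where
  all-false : {w : Word _} → _ ∈ w → all (λ g → memᴳ g S) w ≡ false
  all-false (here refl)  = cong (_∧ _) (memᴳ-∉ S g∉S)
  all-false (there g∈w)  = trans (cong (_ ∧_) (all-false g∈w)) (∧-zeroʳ _)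

coeffWord-dup : (g h : Gen n) (w S : Word n) → g ≈ᴳ h → coeffWord (g ∷ h ∷ w) S ≡ 0ℚ
coeffWord-dup g h w S g≈h rewrite ==ᴳ-≈ᴳ g≈h = refl

coeffWord-single : (g s : Gen n) → g ≈ᴳ s → coeffWord (g ∷ []) (s ∷ []) ≡ 1ℚ
coeffWord-single g s g≈s rewrite ==ᴳ-≈ᴳ g≈s = refl

coeffWord-sorted₂ : (g h s₁ s₂ : Gen n) → g ≈ᴳ s₁ → h ≈ᴳ s₂ → g <ᴳ h →
                    coeffWord (g ∷ h ∷ []) (s₁ ∷ s₂ ∷ []) ≡ 1ℚ
coeffWord-sorted₂ g h s₁ s₂ g≈s₁ h≈s₂ g<h
  rewrite ==ᴳ-≉ᴳ (<ᴳ⇒≉ᴳ g<h)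
        | ==ᴳ-≈ᴳ g≈s₁
        | ==ᴳ-≉ᴳ (λ h≈s₁ → <ᴳ⇒≉ᴳ g<h (≈ᴳ-trans g≈s₁ (≈ᴳ-sym h≈s₁)))
        | ==ᴳ-≈ᴳ h≈s₂
        | >ᴳ-<ᴳ g<h
        = refl

coeffWord₂-zero : (g h s₁ s₂ : Gen n) → ¬ (g ≈ᴳ s₁ × h ≈ᴳ s₂) → ¬ (g ≈ᴳ s₂ × h ≈ᴳ s₁) →
                  coeffWord (g ∷ h ∷ []) (s₁ ∷ s₂ ∷ []) ≡ 0ℚ
coeffWord₂-zero g h s₁ s₂ ¬same ¬swapped with g ≈ᴳ? s₁ | g ≈ᴳ? s₂ | h ≈ᴳ? s₁ | h ≈ᴳ? s₂
... | yes g≈s₁ | _        | yes h≈s₁ | _        = coeffWord-dup g h [] (s₁ ∷ s₂ ∷ []) (≈ᴳ-trans g≈s₁ (≈ᴳ-sym h≈s₁))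
... | yes g≈s₁ | _        | no _     | yes h≈s₂ = ⊥-elim (¬same (g≈s₁ , h≈s₂))
... | no _     | yes g≈s₂ | yes h≈s₁ | _        = ⊥-elim (¬swapped (g≈s₂ , h≈s₁))
... | no _     | yes g≈s₂ | no _     | yes h≈s₂ = coeffWord-dup g h [] (s₁ ∷ s₂ ∷ []) (≈ᴳ-trans g≈s₂ (≈ᴳ-sym h≈s₂))
... | _        | _        | no h≉s₁  | no h≉s₂  = coeffWord-∉ (g ∷ h ∷ []) (s₁ ∷ s₂ ∷ []) (there (here refl)) (h≉s₁ ∷ h≉s₂ ∷ [])
... | no g≉s₁  | no g≉s₂  | _        | _        = coeffWord-∉ (g ∷ h ∷ []) (s₁ ∷ s₂ ∷ []) (here refl) (g≉s₁ ∷ g≉s₂ ∷ [])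

_∈ᵛ_ : ℕ → Gen n → Set
v ∈ᵛ g = v ≡ toℕ (Gen.i g) ⊎ v ≡ toℕ (Gen.j g)

record Adjacent (g h : Gen n) : Set where
  constructor adjacent
  field
    vertex : ℕ
    vertex∈g : vertex ∈ᵛ g
    vertex∈h : vertex ∈ᵛ h

∈ᵛ-resp-≈ᴳ : {v : ℕ} {g h : Gen n} → g ≈ᴳ h → v ∈ᵛ g → v ∈ᵛ h
∈ᵛ-resp-≈ᴳ (i≡ , _) (inj₁ v≡i) = inj₁ (trans v≡i i≡)
∈ᵛ-resp-≈ᴳ (_ , j≡) (inj₂ v≡j) = inj₂ (trans v≡j j≡)

coeffWord-adjacent : (g h s₁ s₂ : Gen n) → Adjacent g h → ¬ Adjacent s₁ s₂ →
                     coeffWord (g ∷ h ∷ []) (s₁ ∷ s₂ ∷ []) ≡ 0ℚ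
coeffWord-adjacent g h s₁ s₂ (adjacent v v∈g v∈h) ¬adj = coeffWord₂-zero g h s₁ s₂
  (λ (g≈s₁ , h≈s₂) → ¬adj (adjacent v (∈ᵛ-resp-≈ᴳ g≈s₁ v∈g) (∈ᵛ-resp-≈ᴳ h≈s₂ v∈h)))
  (λ (g≈s₂ , h≈s₁) → ¬adj (adjacent v (∈ᵛ-resp-≈ᴳ h≈s₁ v∈h) (∈ᵛ-resp-≈ᴳ g≈s₂ v∈g)))

coeff-rel-nonadjacent : {s₁ s₂ : Gen n} → ¬ Adjacent s₁ s₂ → (t : Triple n) → coeff (rel t) (s₁ ∷ s₂ ∷ []) ≡ 0ℚ
coeff-rel-nonadjacent {s₁ = s₁} {s₂} ¬adj t@(triple i j k i<j j<k) = begin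
  coeff (rel t) S                                                    ≡⟨ ⟪⟫-rel (λ w → coeffWord w S) t ⟩
  coeffWord (ikjk t) S - coeffWord (ijjk t) S + coeffWord (ijik t) S
    ≡⟨ cong₂ _+_ (cong₂ _-_ (coeffWord-adjacent eik ejk s₁ s₂ (adjacent (toℕ k) (inj₂ refl) (inj₂ refl)) ¬adj)
                            (coeffWord-adjacent eij ejk s₁ s₂ (adjacent (toℕ j) (inj₂ refl) (inj₁ refl)) ¬adj))
                 (coeffWord-adjacent eij eik s₁ s₂ (adjacent (toℕ i) (inj₁ refl) (inj₁ refl)) ¬adj) ⟩
  0ℚ - 0ℚ + 0ℚ                                                       ≡⟨⟩
  0ℚ                                                                 ∎
  where
  S = s₁ ∷ s₂ ∷ []
  eij = gen i j i<j
  ejk = gen j k j<k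
  eik = gen i k (<-trans i<j j<k)

module _ {n : ℕ} (t s : Triple n) where
  private
    open Triple t
    open Triple s renaming (i to i′; j to j′; k to k′; i<j to i′<j′; j<k to j′<k′)
    eij = gen i j i<j
    ejk = gen j k j<k
    eik = gen i k (<-trans i<j j<k)
    eij′ = gen i′ j′ i′<j′
    ejk′ = gen j′ k′ j′<k′
    eik′ = gen i′ k′ (<-trans i′<j′ j′<k′)

  coeff-rel-ikjk : coeff (rel t) (ikjk s) ≡ coeffWord (ikjk t) (ikjk s)
  coeff-rel-ikjk = begin
    coeff (rel t) (ikjk s)
      ≡⟨ ⟪⟫-rel (λ w → coeffWord w (ikjk s)) t ⟩
    coeffWord (ikjk t) (ikjk s) - coeffWord (ijjk t) (ikjk s) + coeffWord (ijik t) (ikjk s)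
      ≡⟨ cong₂ (λ x y → coeffWord (ikjk t) (ikjk s) - x + y) ijjk≡0 ijik≡0 ⟩
    coeffWord (ikjk t) (ikjk s) - 0ℚ + 0ℚ
      ≡⟨ trans (ℚ.+-identityʳ _) (ℚ.+-identityʳ _) ⟩
    coeffWord (ikjk t) (ikjk s) ∎
    where
    ijjk≡0 : coeffWord (ijjk t) (ikjk s) ≡ 0ℚ
    ijjk≡0 = coeffWord₂-zero eij ejk eik′ ejk′
      (λ ((_ , j≡k′) , (j≡j′ , _)) → ℕ.<⇒≢ j′<k′ (trans (sym j≡j′) j≡k′))
      (λ ((_ , j≡k′) , (j≡i′ , _)) → ℕ.<⇒≢ (ℕ.<-trans i′<j′ j′<k′) (trans (sym j≡i′) j≡k′))
    ijik≡0 : coeffWord (ijik t) (ikjk s) ≡ 0ℚ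
    ijik≡0 = coeffWord₂-zero eij eik eik′ ejk′
      (λ ((i≡i′ , _) , (i≡j′ , _)) → ℕ.<⇒≢ i′<j′ (trans (sym i≡i′) i≡j′))
      (λ ((i≡j′ , _) , (i≡i′ , _)) → ℕ.<⇒≢ i′<j′ (trans (sym i≡i′) i≡j′))

  coeff-rel-ijik : coeff (rel t) (ijik s) ≡ coeffWord (ijik t) (ijik s)
  coeff-rel-ijik = begin
    coeff (rel t) (ijik s)
      ≡⟨ ⟪⟫-rel (λ w → coeffWord w (ijik s)) t ⟩
    coeffWord (ikjk t) (ijik s) - coeffWord (ijjk t) (ijik s) + coeffWord (ijik t) (ijik s)
      ≡⟨ cong₂ (λ x y → x - y + coeffWord (ijik t) (ijik s)) ikjk≡0 ijjk≡0 ⟩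
    0ℚ - 0ℚ + coeffWord (ijik t) (ijik s)
      ≡⟨ ℚ.+-identityˡ _ ⟩
    coeffWord (ijik t) (ijik s) ∎
    where
    ikjk≡0 : coeffWord (ikjk t) (ijik s) ≡ 0ℚ
    ikjk≡0 = coeffWord₂-zero eik ejk eij′ eik′
      (λ ((_ , k≡j′) , (_ , k≡k′)) → ℕ.<⇒≢ j′<k′ (trans (sym k≡j′) k≡k′))
      (λ ((_ , k≡k′) , (_ , k≡j′)) → ℕ.<⇒≢ j′<k′ (trans (sym k≡j′) k≡k′))
    ijjk≡0 : coeffWord (ijjk t) (ijik s) ≡ 0ℚ
    ijjk≡0 = coeffWord₂-zero eij ejk eij′ eik′
      (λ ((_ , j≡j′) , (j≡i′ , _)) → ℕ.<⇒≢ i′<j′ (trans (sym j≡i′) j≡j′))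
      (λ ((_ , j≡k′) , (j≡i′ , _)) → ℕ.<⇒≢ (ℕ.<-trans i′<j′ j′<k′) (trans (sym j≡i′) j≡k′))

  coeffWord-ikjk≡ijik : coeffWord (ikjk t) (ikjk s) ≡ coeffWord (ijik t) (ijik s)
  coeffWord-ikjk≡ijik with (toℕ i ℕ.≟ toℕ i′) ×-dec (toℕ j ℕ.≟ toℕ j′) ×-dec (toℕ k ℕ.≟ toℕ k′)
  ... | yes (i≡ , j≡ , k≡) = trans (coeffWord-sorted₂ eik ejk eik′ ejk′ (i≡ , k≡) (j≡ , k≡) (<ᴳ-i i<j))
                                  (sym (coeffWord-sorted₂ eij eik eij′ eik′ (i≡ , j≡) (i≡ , k≡) (<ᴳ-j refl j<k)))
  ... | no t≢s = trans ikjk≡0 (sym ijik≡0)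
    where
    ikjk≡0 : coeffWord (ikjk t) (ikjk s) ≡ 0ℚ
    ikjk≡0 = coeffWord₂-zero eik ejk eik′ ejk′
      (λ ((i≡ , k≡) , (j≡ , _)) → t≢s (i≡ , j≡ , k≡))
      (λ ((i≡j′ , _) , (j≡i′ , _)) → ℕ.<-asym i′<j′ (subst₂ ℕ._<_ i≡j′ j≡i′ i<j))
    ijik≡0 : coeffWord (ijik t) (ijik s) ≡ 0ℚ
    ijik≡0 = coeffWord₂-zero eij eik eij′ eik′
      (λ ((i≡ , j≡) , (_ , k≡)) → t≢s (i≡ , j≡ , k≡))
      (λ ((_ , j≡k′) , (_ , k≡j′)) → ℕ.<-asym j′<k′ (subst₂ ℕ._<_ j≡k′ k≡j′ j<k))

  coeff-rel-ikjk≡ijik : coeff (rel t) (ikjk s) ≡ coeff (rel t) (ijik s)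
  coeff-rel-ikjk≡ijik = trans coeff-rel-ikjk (trans coeffWord-ikjk≡ijik (sym coeff-rel-ijik))

dual : Λ n → Word n → ℚ
dual φ w = ⟪ coeffWord w ⟫ φ

⟪⟫-dual : (φ x : Λ n) → ⟪ dual φ ⟫ x ≡ ⟪ coeff x ⟫ φ
⟪⟫-dual φ x = ⟪⟫-comm coeffWord x φ

dual-annihilatesIdeal : (φ : Λ n) → Degree≤2 (dual φ) → KillsRelations (dual φ) → AnnihilatesIdeal (dual φ)
dual-annihilatesIdeal φ deg kill z (L , z≈L) = begin
  ⟪ dual φ ⟫ z               ≡⟨ ⟪⟫-dual φ z ⟩
  ⟪ coeff z ⟫ φ              ≡⟨ ⟪⟫-cong φ z≈L ⟩
  ⟪ coeff (idealSum L) ⟫ φ   ≡⟨ ⟪⟫-dual φ (idealSum L) ⟨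
  ⟪ dual φ ⟫ (idealSum L)    ≡⟨ ⟪⟫-idealSum deg kill L ⟩
  0ℚ                         ∎

monomial : Word n → Λ n
monomial S = (1ℚ , S) ∷ []

⟪⟫-dual-monomial : (S : Word n) (x : Λ n) → ⟪ dual (monomial S) ⟫ x ≡ coeff x S
⟪⟫-dual-monomial S x = trans (⟪⟫-dual (monomial S) x) (trans (ℚ.+-identityʳ _) (ℚ.*-identityˡ _))

⟪⟫-dual-difference : (S T : Word n) (x : Λ n) →
                     ⟪ dual (monomial S +Λ ((- 1ℚ) ·Λ monomial T)) ⟫ x ≡ coeff x S - coeff x T
⟪⟫-dual-difference S T x = trans (⟪⟫-dual (monomial S +Λ ((- 1ℚ) ·Λ monomial T)) x)
  (solve 2 (λ A B → con 1ℚ :* A :+ (con (- 1ℚ) :* B :+ con 0ℚ) := A :- B) refl (coeff x S) (coeff x T))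

Homogeneous : ℕ → Λ n → Set
Homogeneous d φ = All (λ (_ , S) → length S ≡ d) φ

dual-homogeneous : {d : ℕ} {φ : Λ n} → Homogeneous d φ → (w : Word n) → length w ≢ d → dual φ w ≡ 0ℚ
dual-homogeneous [] w _ = refl
dual-homogeneous {φ = (q , S) ∷ φ} (|S|≡d ∷ hom) w |w|≢d = begin
  q * coeffWord w S + dual φ w
    ≡⟨ cong₂ _+_ (cong (q *_) (coeffWord-length w S (λ |w|≡|S| → |w|≢d (trans |w|≡|S| |S|≡d))))
                 (dual-homogeneous hom w |w|≢d) ⟩
  q * 0ℚ + 0ℚ
    ≡⟨ trans (ℚ.+-identityʳ _) (ℚ.*-zeroʳ q) ⟩
  0ℚ ∎

dual-degree≤2 : {d : ℕ} {φ : Λ n} → Homogeneous d φ → d ≤ 2 → Degree≤2 (dual φ)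
dual-degree≤2 hom d≤2 w 2<|w| = dual-homogeneous hom w (λ |w|≡d → ℕ.<⇒≱ 2<|w| (ℕ.≤-trans (ℕ.≤-reflexive |w|≡d) d≤2))

monomial₁-annihilatesIdeal : (g : Gen n) → AnnihilatesIdeal (dual (monomial (g ∷ [])))
monomial₁-annihilatesIdeal g = dual-annihilatesIdeal φ (dual-degree≤2 hom (s≤s z≤n))
  (λ t → ⟪⟫-rel-vanishing (dual φ) t (λ g₁ g₂ → dual-homogeneous hom (g₁ ∷ g₂ ∷ []) λ ()))
  where
  φ = monomial (g ∷ [])
  hom : Homogeneous 1 φ
  hom = refl ∷ []

nonadjacent-annihilatesIdeal : {s₁ s₂ : Gen n} → ¬ Adjacent s₁ s₂ → AnnihilatesIdeal (dual (monomial (s₁ ∷ s₂ ∷ [])))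
nonadjacent-annihilatesIdeal {s₁ = s₁} {s₂} ¬adj = dual-annihilatesIdeal φ (dual-degree≤2 {φ = φ} (refl ∷ []) ℕ.≤-refl)
  (λ t → trans (⟪⟫-dual-monomial (s₁ ∷ s₂ ∷ []) (rel t)) (coeff-rel-nonadjacent ¬adj t))
  where φ = monomial (s₁ ∷ s₂ ∷ [])

triangle-annihilatesIdeal : (s : Triple n) → AnnihilatesIdeal (dual (monomial (ijik s) +Λ ((- 1ℚ) ·Λ monomial (ikjk s))))
triangle-annihilatesIdeal s = dual-annihilatesIdeal φ (dual-degree≤2 {φ = φ} (refl ∷ refl ∷ []) ℕ.≤-refl) kill
  where
  φ = monomial (ijik s) +Λ ((- 1ℚ) ·Λ monomial (ikjk s))
  kill : KillsRelations (dual φ)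
  kill t = begin
    ⟪ dual φ ⟫ (rel t)                                ≡⟨ ⟪⟫-dual-difference (ijik s) (ikjk s) (rel t) ⟩
    coeff (rel t) (ijik s) - coeff (rel t) (ikjk s)   ≡⟨ cong (_- coeff (rel t) (ikjk s)) (coeff-rel-ikjk≡ijik t s) ⟨
    coeff (rel t) (ikjk s) - coeff (rel t) (ikjk s)   ≡⟨ ℚ.+-inverseʳ (coeff (rel t) (ikjk s)) ⟩
    0ℚ                                                ∎

lowGen : (i j : Fin n) → inject₁ i < inject₁ j → Gen n
lowGen i j i<j = gen (inject₁ i) (inject₁ j) i<j

LowPairFamily : ℕ → Set
LowPairFamily n = (i j : Fin n) → inject₁ i < inject₁ j → ℚ

lowTerm : LowPairFamily n → Fin n → Fin n → ℚ
lowTerm H i j with inject₁ i <? inject₁ j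
... | yes i<j = H i j i<j
... | no  _   = 0ℚ

∑< : LowPairFamily n → ℚ
∑< {n} H = ∑ (allFin n) (λ i → ∑ (allFin n) (lowTerm H i))

lowTerm-zero : (H : LowPairFamily n) (i j : Fin n) → (∀ i<j → H i j i<j ≡ 0ℚ) → lowTerm H i j ≡ 0ℚ
lowTerm-zero H i j H≡0 with inject₁ i <? inject₁ j
... | yes i<j = H≡0 i<j
... | no  _   = refl

∑<-cong : {H K : LowPairFamily n} → (∀ i j i<j → H i j i<j ≡ K i j i<j) → ∑< H ≡ ∑< K
∑<-cong {n} {H} {K} H≡K = ∑-cong (allFin n) (λ i → ∑-cong (allFin n) (λ j → lowTerm-cong i j))
  where
  lowTerm-cong : ∀ i j → lowTerm H i j ≡ lowTerm K i j
  lowTerm-cong i j with inject₁ i <? inject₁ j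
  ... | yes i<j = H≡K i j i<j
  ... | no  _   = refl

∑<-zero : (H : LowPairFamily n) → (∀ i j i<j → H i j i<j ≡ 0ℚ) → ∑< H ≡ 0ℚ
∑<-zero {n} H H≡0 = ∑-zero (allFin n) (λ i → ∑-zero (allFin n) (λ j → lowTerm-zero H i j (H≡0 i j)))

∑<-δ : (H : LowPairFamily n) (i₀ j₀ : Fin n) (i₀<j₀ : inject₁ i₀ < inject₁ j₀) →
       (∀ i j i<j → ¬ (i ≡ i₀ × j ≡ j₀) → H i j i<j ≡ 0ℚ) → ∑< H ≡ H i₀ j₀ i₀<j₀
∑<-δ H i₀ j₀ i₀<j₀ H≡0 = trans
  (∑-allFin²-δ i₀ j₀ (lowTerm H) (λ i j ≢ → lowTerm-zero H i j (λ i<j → H≡0 i j i<j ≢)))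
  at-i₀j₀
  where
  at-i₀j₀ : lowTerm H i₀ j₀ ≡ H i₀ j₀ i₀<j₀
  at-i₀j₀ with inject₁ i₀ <? inject₁ j₀
  ... | yes i<j = cong (H i₀ j₀) (<-irrelevant i<j i₀<j₀)
  ... | no  i≮j = ⊥-elim (i≮j i₀<j₀)

-- lowPairs and c select their summands by where-bound functions of Defs, which cannot be named;
-- unification recovers them, so that their case split on inject₁ i <? inject₁ j can be replayed.
private
  lowPairs-selector : (n : ℕ) → ∃ λ (pick : Fin n → Fin n → List (Gen n)) →
                      lowPairs n ≡ concatMap (λ i → concatMap (pick i) (allFin n)) (allFin n)
  lowPairs-selector n = _ , refl

  c-selector : (n : ℕ) → ∃ λ (pick : Fin n → Fin n → List (Λ n)) →
               c n ≡ sumΛ (concatMap (λ i → concatMap (pick i) (allFin n)) (allFin n))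
  c-selector n = _ , refl

∑-lowPairs : (h : Gen n → ℚ) → ∑ (lowPairs n) h ≡ ∑< (λ i j i<j → h (lowGen i j i<j))
∑-lowPairs {n} h = trans (∑-concatMap (λ i → concatMap (pick i) (allFin n)) (allFin n) h)
  (∑-cong (allFin n) (λ i → trans (∑-concatMap (pick i) (allFin n) h) (∑-cong (allFin n) (pick-sum i))))
  where
  pick = proj₁ (lowPairs-selector n)
  pick-sum : ∀ i j → ∑ (pick i j) h ≡ lowTerm (λ i j i<j → h (lowGen i j i<j)) i j
  pick-sum i j with inject₁ i <? inject₁ j
  ... | yes _ = ℚ.+-identityʳ _
  ... | no  _ = refl

⟪⟫-a : (f : Word n → ℚ) → ⟪ f ⟫ (a n) ≡ ∑< (λ i j i<j → f (lowGen i j i<j ∷ []))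
⟪⟫-a {n} f = begin
  ⟪ f ⟫ (sumΛ (map e (lowPairs n)))   ≡⟨ ⟪⟫-sumΛ f (map e (lowPairs n)) ⟩
  ∑ (map e (lowPairs n)) ⟪ f ⟫         ≡⟨ ∑-map e (lowPairs n) ⟪ f ⟫ ⟩
  ∑ (lowPairs n) (⟪ f ⟫ ∘ e)           ≡⟨ ∑-cong (lowPairs n) (⟪⟫-e f) ⟩
  ∑ (lowPairs n) (λ g → f (g ∷ []))    ≡⟨ ∑-lowPairs (λ g → f (g ∷ [])) ⟩
  ∑< (λ i j i<j → f (lowGen i j i<j ∷ [])) ∎

⟪⟫-m : (f : Word n → ℚ) → ⟪ f ⟫ (m n) ≡ ∑ (allFin n) (λ l → f (toLast l ∷ []))
⟪⟫-m {n} f = begin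
  ⟪ f ⟫ (sumΛ (map (e ∘ toLast) (allFin n)))   ≡⟨ ⟪⟫-sumΛ f (map (e ∘ toLast) (allFin n)) ⟩
  ∑ (map (e ∘ toLast) (allFin n)) ⟪ f ⟫         ≡⟨ ∑-map (e ∘ toLast) (allFin n) ⟪ f ⟫ ⟩
  ∑ (allFin n) (⟪ f ⟫ ∘ e ∘ toLast)             ≡⟨ ∑-cong (allFin n) (⟪⟫-e f ∘ toLast) ⟩
  ∑ (allFin n) (λ l → f (toLast l ∷ []))        ∎

⟪⟫-am : (f : Word n → ℚ) → ⟪ f ⟫ (a n *Λ m n) ≡ ∑< (λ i j i<j → ∑ (allFin n) (λ l → f (lowGen i j i<j ∷ toLast l ∷ [])))
⟪⟫-am {n} f = begin
  ⟪ f ⟫ (a n *Λ m n)                                          ≡⟨ ⟪⟫-*Λ f (a n) (m n) ⟩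
  ⟪ (λ u → ⟪ (λ v → f (u ++ v)) ⟫ (m n)) ⟫ (a n)              ≡⟨ ⟪⟫-a (λ u → ⟪ (λ v → f (u ++ v)) ⟫ (m n)) ⟩
  ∑< (λ i j i<j → ⟪ (λ v → f (lowGen i j i<j ∷ v)) ⟫ (m n))
                                                              ≡⟨ ∑<-cong (λ i j i<j → ⟪⟫-m (λ v → f (lowGen i j i<j ∷ v))) ⟩
  ∑< (λ i j i<j → ∑ (allFin n) (λ l → f (lowGen i j i<j ∷ toLast l ∷ []))) ∎

cTerms : (Word n → ℚ) → LowPairFamily n
cTerms f i j i<j = f (lowGen i j i<j ∷ toLast i ∷ []) + f (lowGen i j i<j ∷ toLast j ∷ [])

⟪⟫-c : (f : Word n → ℚ) → ⟪ f ⟫ (c n) ≡ ∑< (cTerms f)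
⟪⟫-c {n} f = begin
  ⟪ f ⟫ (sumΛ (concatMap (λ i → concatMap (pick i) (allFin n)) (allFin n)))
    ≡⟨ ⟪⟫-sumΛ f (concatMap (λ i → concatMap (pick i) (allFin n)) (allFin n)) ⟩
  ∑ (concatMap (λ i → concatMap (pick i) (allFin n)) (allFin n)) ⟪ f ⟫
    ≡⟨ ∑-concatMap (λ i → concatMap (pick i) (allFin n)) (allFin n) ⟪ f ⟫ ⟩
  ∑ (allFin n) (λ i → ∑ (concatMap (pick i) (allFin n)) ⟪ f ⟫)
    ≡⟨ ∑-cong (allFin n) (λ i → trans (∑-concatMap (pick i) (allFin n) ⟪ f ⟫) (∑-cong (allFin n) (pick-sum i))) ⟩
  ∑< (cTerms f) ∎
  where
  pick = proj₁ (c-selector n)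
  pick-sum : ∀ i j → ∑ (pick i j) ⟪ f ⟫ ≡ lowTerm (cTerms f) i j
  pick-sum i j with inject₁ i <? inject₁ j
  ... | yes i<j = cong₂ _+_ (⟪⟫-e*e f (lowGen i j i<j) (toLast i))
                            (trans (ℚ.+-identityʳ _) (⟪⟫-e*e f (lowGen i j i<j) (toLast j)))
  ... | no  _   = refl

-- Indices are 0-based: e₁₂ is e_12, toLast l is e_{l+1,n+1} and triangle is 1 < 2 < n+1.
e₁₂ : Gen (suc n)
e₁₂ = gen fz (fs fz) (s≤s z≤n)

triangle : Triple (suc (suc n))
triangle = triple fz (fs fz) (fromℕ _) (s≤s z≤n) (s≤s (s≤s z≤n))

lowGen≉e₁₂ : {i j : Fin (suc (suc n))} {i<j : inject₁ i < inject₁ j} → ¬ (i ≡ fz × j ≡ fs fz) → ¬ lowGen i j i<j ≈ᴳ e₁₂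
lowGen≉e₁₂ {i = i} {j} ≢ (i≡0 , j≡1) =
  ≢ (toℕ-injective (trans (sym (toℕ-inject₁ i)) i≡0) , toℕ-injective (trans (sym (toℕ-inject₁ j)) j≡1))

lowGen≉last : {i j : Fin n} {i<j : inject₁ i < inject₁ j} {l : Fin (suc n)} {l<n : l < fromℕ n} →
              ¬ lowGen i j i<j ≈ᴳ gen l (fromℕ n) l<n
lowGen≉last {n} {j = j} (_ , j≡n) = ℕ.<⇒≢ (toℕ<n j) (trans (sym (toℕ-inject₁ j)) (trans j≡n (toℕ-fromℕ n)))

toLast≉e₁₂ : {l : Fin (suc (suc n))} → ¬ toLast l ≈ᴳ e₁₂
toLast≉e₁₂ (_ , ())

toLast-≉ : {l l′ : Fin n} {l′<n : inject₁ l′ < fromℕ n} → l ≢ l′ → ¬ toLast l ≈ᴳ gen (inject₁ l′) (fromℕ n) l′<n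
toLast-≉ {l = l} {l′} l≢l′ (i≡ , _) = l≢l′ (toℕ-injective (trans (sym (toℕ-inject₁ l)) (trans i≡ (toℕ-inject₁ l′))))

coeff-a-e₁₂ : coeff (a (suc (suc n))) (e₁₂ ∷ []) ≡ 1ℚ
coeff-a-e₁₂ {n} = begin
  coeff (a (suc (suc n))) S   ≡⟨ ⟪⟫-a (λ w → coeffWord w S) ⟩
  ∑< H                        ≡⟨ ∑<-δ H fz (fs fz) (s≤s z≤n) off ⟩
  coeffWord S S               ≡⟨ coeffWord-single {suc (suc n)} e₁₂ e₁₂ (refl , refl) ⟩
  1ℚ                          ∎
  where
  S : Word (suc (suc n))
  S = e₁₂ ∷ []
  H : LowPairFamily (suc (suc n))
  H i j i<j = coeffWord (lowGen i j i<j ∷ []) S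
  off : ∀ i j i<j → ¬ (i ≡ fz × j ≡ fs fz) → H i j i<j ≡ 0ℚ
  off i j i<j ≢ = coeffWord-∉ (lowGen i j i<j ∷ []) S (here refl) (lowGen≉e₁₂ ≢ ∷ [])

coeff-m-e₁₂ : coeff (m (suc (suc n))) (e₁₂ ∷ []) ≡ 0ℚ
coeff-m-e₁₂ {n} = trans (⟪⟫-m (λ w → coeffWord w S))
  (∑-zero (allFin (suc (suc n))) (λ l → coeffWord-∉ (toLast l ∷ []) S (here refl) (toLast≉e₁₂ ∷ [])))
  where
  S : Word (suc (suc n))
  S = e₁₂ ∷ []

coeff-m-e₁ₙ₊₁ : coeff (m (suc n)) (toLast fz ∷ []) ≡ 1ℚ
coeff-m-e₁ₙ₊₁ {n} = begin
  coeff (m (suc n)) S                                   ≡⟨ ⟪⟫-m (λ w → coeffWord w S) ⟩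
  ∑ (allFin (suc n)) (λ l → coeffWord (toLast l ∷ []) S) ≡⟨ ∑-allFin-δ fz (λ l → coeffWord (toLast l ∷ []) S) off ⟩
  coeffWord (toLast fz ∷ []) S                         ≡⟨ coeffWord-single {suc n} (toLast fz) (toLast fz) (refl , refl) ⟩
  1ℚ                                                   ∎
  where
  S : Word (suc n)
  S = toLast fz ∷ []
  off : ∀ l → l ≢ fz → coeffWord (toLast l ∷ []) S ≡ 0ℚ
  off l l≢0 = coeffWord-∉ (toLast l ∷ []) S (here refl) (toLast-≉ l≢0 ∷ [])

e₁₂-e₃ₙ₊₁-nonadjacent : ¬ Adjacent e₁₂ (toLast {suc (suc (suc n))} (fs (fs fz)))
e₁₂-e₃ₙ₊₁-nonadjacent (adjacent _ (inj₁ refl) (inj₁ ()))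
e₁₂-e₃ₙ₊₁-nonadjacent (adjacent _ (inj₁ refl) (inj₂ ()))
e₁₂-e₃ₙ₊₁-nonadjacent (adjacent _ (inj₂ refl) (inj₁ ()))
e₁₂-e₃ₙ₊₁-nonadjacent (adjacent _ (inj₂ refl) (inj₂ ()))

coeff-am-e₁₂e₃ₙ₊₁ : coeff (a (suc (suc (suc n))) *Λ m (suc (suc (suc n)))) (e₁₂ ∷ toLast (fs (fs fz)) ∷ []) ≡ 1ℚ
coeff-am-e₁₂e₃ₙ₊₁ {n} = begin
  coeff (a N *Λ m N) S
    ≡⟨ ⟪⟫-am (λ w → coeffWord w S) ⟩
  ∑< H
    ≡⟨ ∑<-δ H fz (fs fz) (s≤s z≤n) off ⟩
  ∑ (allFin N) (λ l → coeffWord (e₁₂ ∷ toLast l ∷ []) S)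
    ≡⟨ ∑-allFin-δ (fs (fs fz)) (λ l → coeffWord (e₁₂ ∷ toLast l ∷ []) S) offₗ ⟩
  coeffWord (e₁₂ ∷ toLast (fs (fs fz)) ∷ []) S
    ≡⟨ coeffWord-sorted₂ {N} e₁₂ (toLast (fs (fs fz))) e₁₂ (toLast (fs (fs fz)))
                         (refl , refl) (refl , refl) (<ᴳ-i (s≤s z≤n)) ⟩
  1ℚ ∎
  where
  N = suc (suc (suc n))
  S : Word N
  S = e₁₂ ∷ toLast (fs (fs fz)) ∷ []
  H : LowPairFamily N
  H i j i<j = ∑ (allFin N) (λ l → coeffWord (lowGen i j i<j ∷ toLast l ∷ []) S)
  off : ∀ i j i<j → ¬ (i ≡ fz × j ≡ fs fz) → H i j i<j ≡ 0ℚ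
  off i j i<j ≢ = ∑-zero (allFin N) (λ l →
    coeffWord-∉ (lowGen i j i<j ∷ toLast l ∷ []) S (here refl) (lowGen≉e₁₂ ≢ ∷ lowGen≉last ∷ []))
  offₗ : ∀ l → l ≢ fs (fs fz) → coeffWord (e₁₂ ∷ toLast l ∷ []) S ≡ 0ℚ
  offₗ l l≢2 = coeffWord-∉ (e₁₂ ∷ toLast l ∷ []) S (there (here refl)) (toLast≉e₁₂ ∷ toLast-≉ l≢2 ∷ [])

coeff-c-nonadjacent : {s₁ s₂ : Gen n} → ¬ Adjacent s₁ s₂ → coeff (c n) (s₁ ∷ s₂ ∷ []) ≡ 0ℚ
coeff-c-nonadjacent {s₁ = s₁} {s₂} ¬adj = trans (⟪⟫-c (λ w → coeffWord w S))
  (∑<-zero (cTerms (λ w → coeffWord w S)) (λ i j i<j → cong₂ _+_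
    (coeffWord-adjacent (lowGen i j i<j) (toLast i) s₁ s₂ (adjacent (toℕ (inject₁ i)) (inj₁ refl) (inj₁ refl)) ¬adj)
    (coeffWord-adjacent (lowGen i j i<j) (toLast j) s₁ s₂ (adjacent (toℕ (inject₁ j)) (inj₂ refl) (inj₁ refl)) ¬adj)))
  where S = s₁ ∷ s₂ ∷ []

coeff-c-ijik-triangle : coeff (c (suc (suc n))) (ijik triangle) ≡ 1ℚ
coeff-c-ijik-triangle {n} = begin
  coeff (c (suc (suc n))) S
    ≡⟨ ⟪⟫-c (λ w → coeffWord w S) ⟩
  ∑< (cTerms (λ w → coeffWord w S))
    ≡⟨ ∑<-δ (cTerms (λ w → coeffWord w S)) fz (fs fz) (s≤s z≤n) off ⟩
  coeffWord (e₁₂ ∷ toLast fz ∷ []) S + coeffWord (e₁₂ ∷ toLast (fs fz) ∷ []) S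
    ≡⟨ cong₂ _+_ (coeffWord-sorted₂ e₁₂ (toLast fz) e₁₂ e₁ₙ₊₁ (refl , refl) (refl , refl) (<ᴳ-j refl (s≤s (s≤s z≤n))))
                 (coeffWord-∉ (e₁₂ ∷ toLast (fs fz) ∷ []) S (there (here refl)) (toLast≉e₁₂ ∷ (λ { (() , _) }) ∷ [])) ⟩
  1ℚ + 0ℚ
    ≡⟨⟩
  1ℚ ∎
  where
  e₁ₙ₊₁ : Gen (suc (suc n))
  e₁ₙ₊₁ = gen fz (fromℕ _) (<-trans (s≤s z≤n) (s≤s (s≤s z≤n)))
  S : Word (suc (suc n))
  S = e₁₂ ∷ e₁ₙ₊₁ ∷ []
  off : ∀ i j i<j → ¬ (i ≡ fz × j ≡ fs fz) → cTerms (λ w → coeffWord w S) i j i<j ≡ 0ℚ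
  off i j i<j ≢ = cong₂ _+_
    (coeffWord-∉ (lowGen i j i<j ∷ toLast i ∷ []) S (here refl) (lowGen≉e₁₂ ≢ ∷ lowGen≉last ∷ []))
    (coeffWord-∉ (lowGen i j i<j ∷ toLast j ∷ []) S (here refl) (lowGen≉e₁₂ ≢ ∷ lowGen≉last ∷ []))

coeff-c-ikjk-triangle : coeff (c (suc (suc n))) (ikjk triangle) ≡ 0ℚ
coeff-c-ikjk-triangle {n} = trans (⟪⟫-c (λ w → coeffWord w S))
  (∑<-zero (cTerms (λ w → coeffWord w S)) (λ i j i<j → cong₂ _+_
    (coeffWord-∉ (lowGen i j i<j ∷ toLast i ∷ []) S (here refl) (lowGen≉last ∷ lowGen≉last ∷ []))
    (coeffWord-∉ (lowGen i j i<j ∷ toLast j ∷ []) S (here refl) (lowGen≉last ∷ lowGen≉last ∷ []))))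
  where
  S : Word (suc (suc n))
  S = ikjk triangle

lemma5p6 : ((n : ℕ) → 2 ≤ n → LinIndep₂ (a n) (m n))
         × ((n : ℕ) → 3 ≤ n → LinIndep₂ (a n *Λ m n) (c n))
lemma5p6 = part1 , part2
  where
  part1 : (n : ℕ) → 2 ≤ n → LinIndep₂ (a n) (m n)
  part1 n@(suc (suc k)) (s≤s (s≤s z≤n)) = linIndep₂-triangular (a n) (m n)
    (monomial₁-annihilatesIdeal e₁₂) (monomial₁-annihilatesIdeal (toLast fz))
    (trans (⟪⟫-dual-monomial (e₁₂ ∷ []) (a n)) (coeff-a-e₁₂ {k}))
    (trans (⟪⟫-dual-monomial (e₁₂ ∷ []) (m n)) (coeff-m-e₁₂ {k}))
    (trans (⟪⟫-dual-monomial (toLast fz ∷ []) (m n)) (coeff-m-e₁ₙ₊₁ {suc k}))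
  part2 : (n : ℕ) → 3 ≤ n → LinIndep₂ (a n *Λ m n) (c n)
  part2 n@(suc (suc (suc k))) (s≤s (s≤s (s≤s z≤n))) = linIndep₂-triangular (a n *Λ m n) (c n)
    (nonadjacent-annihilatesIdeal (e₁₂-e₃ₙ₊₁-nonadjacent {k})) (triangle-annihilatesIdeal triangle)
    (trans (⟪⟫-dual-monomial S (a n *Λ m n)) (coeff-am-e₁₂e₃ₙ₊₁ {k}))
    (trans (⟪⟫-dual-monomial S (c n)) (coeff-c-nonadjacent (e₁₂-e₃ₙ₊₁-nonadjacent {k})))
    (trans (⟪⟫-dual-difference (ijik triangle) (ikjk triangle) (c n))
           (cong₂ _-_ (coeff-c-ijik-triangle {suc k}) (coeff-c-ikjk-triangle {suc k})))
    where S = e₁₂ ∷ toLast (fs (fs fz)) ∷ []
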